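{- Let $p$ be an odd prime, $k$ an algebraically closed field of characteristic $p$, and $d=p^2+1$. Let $X\to\mathbb P^1$ be the Artin–Schreier cover defined by $y^p-y=-x^{d}-x^{d/2+p}$. For every $\alpha=y^mx^n\,dx\in\mathcal B_X$ with $m\ge\frac{p-1}{2}$, we have $\mathcal C_X(\alpha)\notin\operatorname{Span}\{\mathcal C_X(\beta):\beta\in\mathcal B_X,\ \beta<\alpha\}$.
   Context: An Artin–Schreier cover is a $\mathbb Z/p\mathbb Z$-Galois cover $X\to\mathbb P^1$ of smooth projective connected curves over $k$, given by an equation $y^p-y=f(x)$. For $f\in k[x]$ of degree $d$ prime to $p$, the set $\mathcal B_X=\{y^ix^j\,dx:\ 0\le i\le p-2,\ 0\le j\le \lceil (p-i-1)d/p\rceil-2\}$ is a $k$-basis of $H^0(X,\Omega^1_X)$. $\mathcal C_X$ is the Cartier operator on $H^0(X,\Omega^1_X)$, the $p^{ -1}$-semilinear map with $\mathcal C_X(f^p\alpha+\beta)=f\,\mathcal C_X(\alpha)+\mathcal C_X(\beta)$, $\mathcal C_X(x^{p-1}dx)=dx$, and $\mathcal C_X(x^ndx)=0$ for $n\not\equiv-1\pmod p$. $\mathcal B_X$ is ordered lexicographically with $y>x$: $y^ix^jdx>y^ax^bdx$ iff $i>a$, or $i=a$ and $j>b$. -}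

module Defs where

open import Level using (Level; _⊔_)
open import Data.Nat using (ℕ; zero; suc; _+_; _*_; _∸_; _^_; _≤_; _<ᵇ_; _≡ᵇ_; _≟_)
open import Data.Nat.DivMod using (_/_)
open import Data.Nat.Combinatorics using (_C_)
open import Data.Bool using (Bool; if_then_else_; _∧_; _∨_)
open import Data.List using (List; []; _∷_; map; concatMap; upTo; filterᵇ; foldr; length)
open import Data.Product using (_×_; _,_; Σ; proj₁; proj₂)
open import Relation.Nullary using (¬_; Dec; does)
open import Algebra.Bundles using (CommutativeRing)

module _ {c ℓ : Level} (K : CommutativeRing c ℓ) where
  open CommutativeRing K renaming (_+_ to _+ᴷ_; _*_ to _*ᴷ_)

  ι : ℕ → Carrier
  ι zero    = 0#
  ι (suc n) = 1# +ᴷ ι n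

  -- evaluation of the monic polynomial  z^(length as) + Σ_i as[i] z^i
  -- (as = list of lower coefficients a_0, a_1, ..., a_{n-1})
  evalMonic : List Carrier → Carrier → Carrier
  evalMonic []       z = 1#
  evalMonic (a ∷ as) z = a +ᴷ z *ᴷ evalMonic as z

  record IsField : Set (c ⊔ ℓ) where
    field
      1≉0 : ¬ (1# ≈ 0#)
      inverse : ∀ x → ¬ (x ≈ 0#) → Σ Carrier (λ y → x *ᴷ y ≈ 1#)

  -- characteristic p (for p prime in a field this means char K = p exactly)
  HasChar : ℕ → Set ℓ
  HasChar p = ι p ≈ 0#

  IsAlgClosed : Set (c ⊔ ℓ)
  IsAlgClosed = ∀ (a : Carrier) (as : List Carrier) →
    Σ Carrier (λ z → evalMonic (a ∷ as) z ≈ 0#)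

dAS : ℕ → ℕ
dAS p = p ^ 2 + 1

eAS : ℕ → ℕ
eAS p = dAS p / 2 + p

-- ceiling division ⌈A/q⌉ (q = 0 never used)
ceilDiv : ℕ → ℕ → ℕ
ceilDiv A zero    = 0
ceilDiv A (suc q) = (A + q) / suc q

-- number of admissible j for given i:  j ≤ ⌈(p-i-1)d/p⌉ - 2  ⇔  j < ⌈(p-i-1)d/p⌉ - 1
jCount : ℕ → ℕ → ℕ
jCount p i = ceilDiv ((p ∸ i ∸ 1) * dAS p) p ∸ 1

-- the basis B_X, element y^i x^j dx encoded as (i , j), 0 ≤ i ≤ p-2
basisAS : ℕ → List (ℕ × ℕ)
basisAS p = concatMap (λ i → map (λ j → (i , j)) (upTo (jCount p i))) (upTo (p ∸ 1))

-- lexicographic order with y > x:  (a , b) < (m , n)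
lexLtᵇ : ℕ × ℕ → ℕ × ℕ → Bool
lexLtᵇ (a , b) (m , n) = (a <ᵇ m) ∨ ((a ≡ᵇ m) ∧ (b <ᵇ n))

lowerBasis : ℕ → ℕ × ℕ → List (ℕ × ℕ)
lowerBasis p α = filterᵇ (λ β → lexLtᵇ β α) (basisAS p)

-- Write y = y^p - f and  -f = x^d + x^e.  Then
--   y^m x^n dx = Σ_l (m C l) y^(p l) (x^d + x^e)^(m-l) x^n dx
--              = Σ_l Σ_s (m C l) ((m-l) C s) y^(p l) x^(d s + e (m-l-s) + n) dx,
-- and C(y^(pl) x^N dx) = y^l x^t dx if N + 1 = p (t+1), and 0 otherwise
-- (all coefficients lie in F_p, on which p-th roots are the identity).
-- cartierCoeff p m n l t ∈ ℕ is the coefficient of y^l x^t dx in C(y^m x^n dx),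
-- as an integer whose image in k is the actual coefficient.

sumUpTo : ℕ → (ℕ → ℕ) → ℕ
sumUpTo zero    g = 0
sumUpTo (suc r) g = sumUpTo r g + g r

cartierCoeff : ℕ → ℕ → ℕ → ℕ → ℕ → ℕ
cartierCoeff p m n l t =
  (m C l) * sumUpTo (suc (m ∸ l)) (λ s →
     if does ((dAS p * s + eAS p * (m ∸ l ∸ s) + n + 1) ≟ (p * (t + 1)))
     then ((m ∸ l) C s) else 0)

module _ {c ℓ : Level} (K : CommutativeRing c ℓ) where
  open CommutativeRing K renaming (_+_ to _+ᴷ_; _*_ to _*ᴷ_)

  combCoeff : ℕ → (ℕ × ℕ → Carrier) → List (ℕ × ℕ) → ℕ → ℕ → Carrier
  combCoeff p coef βs l t =
    foldr (λ β acc → coef β *ᴷ ι K (cartierCoeff p (proj₁ β) (proj₂ β) l t) +ᴷ acc) 0# βs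

  InSpanOfLower : ℕ → ℕ × ℕ → Set (c ⊔ ℓ)
  InSpanOfLower p α =
    Σ (ℕ × ℕ → Carrier) (λ coef → ∀ l t →
      ι K (cartierCoeff p (proj₁ α) (proj₂ α) l t) ≈ combCoeff p coef (lowerBasis p α) l t)

-- Write y = y^p + x^d + x^e (e = d/2 + p) and expand α = y^m x^n dx.  The term with l factors
-- y^p, s factors x^d and v = m - l - s factors x^e contributes to the coefficient of y^l x^t dx
-- in C_X(α) exactly when d s + e v + n + 1 = p (t + 1).  As d ≡ 1 and 2 e ≡ 1 (mod p), some
-- pivot split k = s + v with v ≤ 1 and k ≤ (p - 1)/2 ≤ m satisfies this, so y^(m-k) x^t dx
-- occurs in C_X(α) with the unit coefficient (m C k)(k C s).  It occurs in no C_X(β) with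
-- β = y^a x^b dx < α: for a < m - k the binomial (a C (m-k)) vanishes; for a < m the basis
-- bound b < (p - 1 - a) p makes all exponents of β smaller than that of the pivot; for a = m
-- we have b < n and s ↦ d s + e (k - s) is increasing, except for the split (s + 1, 0) when
-- v = 1, whose exponent is ≡ s + b + 2 ≢ 0 (mod p).

module Submission where

open import Defs
open import Level using (Level)
open import Algebra.Bundles using (CommutativeRing)
open import Data.Bool using (T; if_then_else_)
open import Data.Bool.Properties using (T-∨; T-∧)
open import Data.Empty using (⊥-elim)
open import Data.List using ([]; _∷_; map; upTo)
open import Data.List.Membership.Propositional using (_∈_; find)
open import Data.List.Membership.Propositional.Properties
  using (∈-concatMap⁻; ∈-map⁻; ∈-upTo⁻; ∈-filter⁻)
open import Data.List.Relation.Unary.Any using (here; there)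
open import Data.Nat
open import Data.Nat.Properties
open import Data.Nat.Combinatorics using (_C_; k>n⇒nCk≡0; nCk≡n!/k![n-k]!; k![n∸k]!∣n!)
open import Data.Nat.Coprimality using (prime⇒coprime; coprime-Bézout)
open import Data.Nat.Divisibility
open import Data.Nat.DivMod using (_%_; _/_; m≡m%n+[m/n]*n; m%n<n; m*n/n≡m; m<n*o⇒m/o<n; m/n*n≡m)
open import Data.Nat.GCD using (module Bézout)
open import Data.Nat.Tactic.RingSolver using (solve)
open import Data.Nat.Primality using (Prime; euclidsLemma; prime⇒nonZero; prime⇒nonTrivial)
open import Data.Product using (_×_; _,_; proj₁; proj₂; ∃; ∃₂)
open import Data.Sum using (_⊎_; inj₁; inj₂)
open import Function using (_∘_)
open import Function.Bundles using (Equivalence)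
open import Relation.Binary.PropositionalEquality
  using (_≡_; _≢_; refl; sym; trans; cong; cong₂; subst; module ≡-Reasoning)
open import Relation.Binary.Definitions using (tri<; tri≈; tri>)
open import Relation.Nullary using (¬_; Dec; yes; no; does)
open import Relation.Nullary.Decidable using (T?; dec-true; dec-false)

Separates : ℕ → ℕ × ℕ → ℕ → ℕ → Set
Separates p (m , n) l t =
  p ∤ cartierCoeff p m n l t ×
  (∀ {β} → β ∈ lowerBasis p (m , n) → cartierCoeff p (proj₁ β) (proj₂ β) l t ≡ 0)

module _ {c ℓ : Level} (K : CommutativeRing c ℓ) where
  open CommutativeRing K
    using (_≈_; 0#; 1#; setoid; semiring; +-cong; +-congˡ; *-congˡ; zeroʳ)
    renaming (_+_ to _+ᴷ_; _*_ to _*ᴷ_; +-identityʳ to +ᴷ-identityʳ;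
              refl to ≈-refl; trans to ≈-trans; reflexive to ≈-reflexive)
  open import Algebra.Properties.Semiring.Mult semiring
    using (×-homo-+; ×1-homo-*) renaming (_×_ to _·_)
  open import Relation.Binary.Reasoning.Setoid setoid

  ι≡·1# : ∀ n → ι K n ≡ n · 1#
  ι≡·1# zero    = refl
  ι≡·1# (suc n) = cong (1# +ᴷ_) (ι≡·1# n)

  ι-homo-+ : ∀ m n → ι K (m + n) ≈ ι K m +ᴷ ι K n
  ι-homo-+ m n rewrite ι≡·1# (m + n) | ι≡·1# m | ι≡·1# n = ×-homo-+ 1# m n

  ι-homo-* : ∀ m n → ι K (m * n) ≈ ι K m *ᴷ ι K n
  ι-homo-* m n rewrite ι≡·1# (m * n) | ι≡·1# m | ι≡·1# n = ×1-homo-* m n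

  ι-multiple≈0 : ∀ x {a} → ι K a ≈ 0# → ι K (x * a) ≈ 0#
  ι-multiple≈0 x {a} ιa≈0 = begin
    ι K (x * a)       ≈⟨ ι-homo-* x a ⟩
    ι K x *ᴷ ι K a    ≈⟨ *-congˡ ιa≈0 ⟩
    ι K x *ᴷ 0#       ≈⟨ zeroʳ _ ⟩
    0#                ∎

  1+jv≡iu⇒1≈0 : ∀ {u v} i j → 1 + j * v ≡ i * u → ι K u ≈ 0# → ι K v ≈ 0# → 1# ≈ 0#
  1+jv≡iu⇒1≈0 {u} {v} i j eq ιu≈0 ιv≈0 = begin
    1#               ≈⟨ +ᴷ-identityʳ 1# ⟨
    1# +ᴷ 0#         ≈⟨ +-congˡ (ι-multiple≈0 j ιv≈0) ⟨
    ι K (1 + j * v)  ≡⟨ cong (ι K) eq ⟩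
    ι K (i * u)      ≈⟨ ι-multiple≈0 i ιu≈0 ⟩
    0#               ∎

  bézout⇒1≈0 : ∀ {a b} → Bézout.Identity 1 a b → ι K a ≈ 0# → ι K b ≈ 0# → 1# ≈ 0#
  bézout⇒1≈0 (Bézout.+- x y eq) ιa≈0 ιb≈0 = 1+jv≡iu⇒1≈0 x y eq ιa≈0 ιb≈0
  bézout⇒1≈0 (Bézout.-+ x y eq) ιa≈0 ιb≈0 = 1+jv≡iu⇒1≈0 y x eq ιb≈0 ιa≈0

  ι≈0⇒∣ : ¬ (1# ≈ 0#) → ∀ {p} → Prime p → HasChar K p → ∀ x → ι K x ≈ 0# → p ∣ x
  ι≈0⇒∣ 1≉0 {p} p-prime char x ιx≈0 = byResidue (x % p ≟ 0)
    where
    instance _ = prime⇒nonZero p-prime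

    ι[x%p]≈0 : ι K (x % p) ≈ 0#
    ι[x%p]≈0 = begin
      ι K (x % p)                     ≈⟨ +ᴷ-identityʳ _ ⟨
      ι K (x % p) +ᴷ 0#               ≈⟨ +-congˡ (ι-multiple≈0 (x / p) char) ⟨
      ι K (x % p) +ᴷ ι K (x / p * p)  ≈⟨ ι-homo-+ (x % p) (x / p * p) ⟨
      ι K (x % p + x / p * p)         ≡⟨ cong (ι K) (m≡m%n+[m/n]*n x p) ⟨
      ι K x                           ≈⟨ ιx≈0 ⟩
      0#                              ∎

    byResidue : Dec (x % p ≡ 0) → p ∣ x
    byResidue (yes x%p≡0) = m%n≡0⇒n∣m x p x%p≡0
    byResidue (no  x%p≢0) = ⊥-elim (1≉0 (bézout⇒1≈0 identity char ι[x%p]≈0))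
      where
      identity : Bézout.Identity 1 p (x % p)
      identity = coprime-Bézout (prime⇒coprime p-prime {{≢-nonZero x%p≢0}} (m%n<n x p))

  combCoeff≈0 : ∀ p coef βs l t →
    (∀ {β} → β ∈ βs → cartierCoeff p (proj₁ β) (proj₂ β) l t ≡ 0) →
    combCoeff K p coef βs l t ≈ 0#
  combCoeff≈0 p coef []       l t vanish = ≈-refl
  combCoeff≈0 p coef (β ∷ βs) l t vanish = begin
    coef β *ᴷ ι K (cartierCoeff p (proj₁ β) (proj₂ β) l t) +ᴷ combCoeff K p coef βs l t
      ≈⟨ +-cong (*-congˡ (≈-reflexive (cong (ι K) (vanish (here refl)))))
                (combCoeff≈0 p coef βs l t (vanish ∘ there)) ⟩
    coef β *ᴷ 0# +ᴷ 0#  ≈⟨ +ᴷ-identityʳ _ ⟩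
    coef β *ᴷ 0#        ≈⟨ zeroʳ _ ⟩
    0#                  ∎

  separated⇒¬InSpanOfLower : ¬ (1# ≈ 0#) → ∀ {p} → Prime p → HasChar K p →
    ∀ {α} → ∃₂ (Separates p α) → ¬ InSpanOfLower K p α
  separated⇒¬InSpanOfLower 1≉0 {p} p-prime char {α} (l , t , p∤coeff , lowerVanish)
                           (coef , inSpan) =
    p∤coeff (ι≈0⇒∣ 1≉0 p-prime char _
      (≈-trans (inSpan l t) (combCoeff≈0 p coef (lowerBasis p α) l t lowerVanish)))

prime∤n! : ∀ {p n} → Prime p → n < p → p ∤ n !
prime∤n! {n = zero}  p-prime _   p∣1  = nonTrivial⇒≢1 {{prime⇒nonTrivial p-prime}} (∣1⇒≡1 p∣1)
prime∤n! {n = suc n} p-prime n<p p∣n! with euclidsLemma (suc n) (n !) p-prime p∣n!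
... | inj₁ p∣1+n = <⇒≱ n<p (∣⇒≤ p∣1+n)
... | inj₂ p∣n!′ = prime∤n! p-prime (<-trans (n<1+n n) n<p) p∣n!′

prime∤nCk : ∀ {p n k} → Prime p → k ≤ n → n < p → p ∤ n C k
prime∤nCk {p} {n} {k} p-prime k≤n n<p p∣nCk =
  prime∤n! p-prime n<p (subst (p ∣_) nCk*k![n∸k]!≡n! (∣m⇒∣m*n _ p∣nCk))
  where
  instance _ = k !* (n ∸ k) !≢0
  nCk*k![n∸k]!≡n! : (n C k) * (k ! * (n ∸ k) !) ≡ n !
  nCk*k![n∸k]!≡n! = trans (cong (_* (k ! * (n ∸ k) !)) (nCk≡n!/k![n-k]! k≤n))
                          (m/n*n≡m (k![n∸k]!∣n! k≤n))

sumUpTo-≡0 : ∀ R g → (∀ s → s < R → g s ≡ 0) → sumUpTo R g ≡ 0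
sumUpTo-≡0 zero    g vanish = refl
sumUpTo-≡0 (suc R) g vanish =
  cong₂ _+_ (sumUpTo-≡0 R g (λ s s<R → vanish s (m<n⇒m<1+n s<R))) (vanish R (n<1+n R))

sumUpTo-single : ∀ R g {s} → s < R → (∀ s′ → s′ < R → s′ ≢ s → g s′ ≡ 0) → sumUpTo R g ≡ g s
sumUpTo-single (suc R) g {s} s<1+R vanish with s ≟ R
... | yes refl = cong (_+ g R) (sumUpTo-≡0 R g (λ s′ s′<R → vanish s′ (m<n⇒m<1+n s′<R) (<⇒≢ s′<R)))
... | no  s≢R  = begin
  sumUpTo R g + g R  ≡⟨ cong₂ _+_ (sumUpTo-single R g (≤∧≢⇒< (s≤s⁻¹ s<1+R) s≢R) vanishBelowR)
                                  (vanish R (n<1+n R) (s≢R ∘ sym)) ⟩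
  g s + 0            ≡⟨ +-identityʳ (g s) ⟩
  g s                ∎
  where
  open ≡-Reasoning
  vanishBelowR : ∀ s′ → s′ < R → s′ ≢ s → g s′ ≡ 0
  vanishBelowR s′ s′<R = vanish s′ (m<n⇒m<1+n s′<R)

weight-< : ∀ {d e s v s′ v′} → e < d → s′ < s → s′ + v′ ≡ s + v → d * s′ + e * v′ < d * s + e * v
weight-< {d} {e} {s} {v} {s′} {v′} e<d s′<s same with m≤n⇒∃[o]m+o≡n s′<s
... | u , refl = begin-strict
  d * s′ + e * v′               ≡⟨ cong (λ w → d * s′ + e * w) v′≡1+u+v ⟩
  d * s′ + e * (suc u + v)      ≡⟨ solve (d ∷ e ∷ s′ ∷ u ∷ v ∷ []) ⟩
  d * s′ + e * v + e * suc u    <⟨ +-monoʳ-< (d * s′ + e * v) (*-monoˡ-< (suc u) e<d) ⟩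
  d * s′ + e * v + d * suc u    ≡⟨ solve (d ∷ e ∷ s′ ∷ u ∷ v ∷ []) ⟩
  d * (suc s′ + u) + e * v      ∎
  where
  open ≤-Reasoning
  v′≡1+u+v : v′ ≡ suc u + v
  v′≡1+u+v = +-cancelˡ-≡ s′ v′ (suc u + v) (trans same (solve (s′ ∷ u ∷ v ∷ [])))

weight-injective : ∀ {d e s v s′ v′} → e < d → s′ + v′ ≡ s + v →
  d * s′ + e * v′ ≡ d * s + e * v → s′ ≡ s
weight-injective {s = s} {s′ = s′} e<d same eq with <-cmp s′ s
... | tri< s′<s _ _ = ⊥-elim (<⇒≢ (weight-< e<d s′<s same) eq)
... | tri≈ _ s′≡s _ = s′≡s
... | tri> _ _ s<s′ = ⊥-elim (<⇒≢ (weight-< e<d s<s′ (sym same)) (sym eq))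

weight≤ : ∀ {d e} s v → e ≤ d → d * s + e * v ≤ d * (s + v)
weight≤ {d} {e} s v e≤d = begin
  d * s + e * v  ≤⟨ +-monoʳ-≤ (d * s) (*-monoˡ-≤ v e≤d) ⟩
  d * s + d * v  ≡⟨ *-distribˡ-+ d s v ⟨
  d * (s + v)    ∎
  where open ≤-Reasoning

weight≥ : ∀ {d e s v k} → e ≤ d → v ≤ 1 → s + v ≡ suc k → d * k + e ≤ d * s + e * v
weight≥ {d} {e} {s} {zero} {k} e≤d _ s+0≡1+k rewrite +-identityʳ s | s+0≡1+k = begin
  d * k + e          ≤⟨ +-monoʳ-≤ (d * k) e≤d ⟩
  d * k + d          ≡⟨ solve (d ∷ e ∷ k ∷ []) ⟩
  d * suc k + e * 0  ∎
  where open ≤-Reasoning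
weight≥ {d} {e} {s} {suc zero} {k} e≤d _ s+1≡1+k
  rewrite +-cancelʳ-≡ 1 s k (trans s+1≡1+k (+-comm 1 k)) =
    ≤-reflexive (cong (d * k +_) (sym (*-identityʳ e)))
weight≥ {v = 2+ _} _ (s≤s ()) _

nextSplit : ∀ {s v s′ v′} → v ≤ 1 → s < s′ → s′ + v′ ≡ s + v → s′ ≡ suc s × v′ ≡ 0 × v ≡ 1
nextSplit {s} {v} {s′} {v′} v≤1 s<s′ same with m≤n⇒∃[o]m+o≡n s<s′
... | u , refl = trans (cong (suc s +_) (m+n≡0⇒m≡0 u u+v′≡0)) (+-identityʳ (suc s))
               , m+n≡0⇒n≡0 u u+v′≡0
               , trans (sym 1+u+v′≡v) (cong suc u+v′≡0)
  where
  1+u+v′≡v : suc (u + v′) ≡ v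
  1+u+v′≡v = +-cancelˡ-≡ s (suc (u + v′)) v
    (trans (+-suc s (u + v′)) (trans (cong suc (sym (+-assoc s u v′))) same))
  u+v′≡0 : u + v′ ≡ 0
  u+v′≡0 = n≤0⇒n≡0 (s≤s⁻¹ (subst (_≤ 1) (sym 1+u+v′≡v) v≤1))

shiftedSplit : ∀ d e s b n → d * suc s + e * 0 + b + 1 ≡ d * s + e * 1 + n + 1 → d + b ≡ e + n
shiftedSplit d e s b n eq = +-cancelˡ-≡ (d * s) (d + b) (e + n) (+-cancelʳ-≡ 1 _ _ (begin
  d * s + (d + b) + 1        ≡⟨ solve (d ∷ e ∷ s ∷ b ∷ []) ⟩
  d * suc s + e * 0 + b + 1  ≡⟨ eq ⟩
  d * s + e * 1 + n + 1      ≡⟨ solve (d ∷ e ∷ s ∷ n ∷ []) ⟩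
  d * s + (e + n) + 1        ∎))
  where open ≡-Reasoning

complementResidue : ∀ p .{{_ : NonZero p}} x → ∃ λ r → r < p × p ∣ r + x
complementResidue p x with x % p | m%n<n x p | m≡m%n+[m/n]*n x p
... | zero  | _   | x≡x/p*p   = 0 , >-nonZero⁻¹ p , divides (x / p) x≡x/p*p
... | suc i | 1+i<p | x≡1+i+x/p*p =
  p ∸ suc i , ∸-monoʳ-< z<s (<⇒≤ 1+i<p) , divides (suc (x / p)) (begin
  p ∸ suc i + x                  ≡⟨ cong (p ∸ suc i +_) x≡1+i+x/p*p ⟩
  p ∸ suc i + (suc i + x / p * p)  ≡⟨ +-assoc (p ∸ suc i) (suc i) _ ⟨
  p ∸ suc i + suc i + x / p * p    ≡⟨ cong (_+ x / p * p) (m∸n+n≡m (<⇒≤ 1+i<p)) ⟩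
  p + x / p * p                  ∎)
  where open ≡-Reasoning

∣+1⇒≡*[+1] : ∀ {p x} → p ∣ x + 1 → ∃ λ t → x + 1 ≡ p * (t + 1)
∣+1⇒≡*[+1] {p} {x} (divides zero    x+1≡0) = ⊥-elim (1+n≢0 (trans (+-comm 1 x) x+1≡0))
∣+1⇒≡*[+1] {p} {x} (divides (suc t) x+1≡[1+t]p) =
  t , trans x+1≡[1+t]p (trans (*-comm (suc t) p) (cong (p *_) (+-comm 1 t)))

∈basisAS⁻ : ∀ p {a b} → (a , b) ∈ basisAS p → a < p ∸ 1 × b < jCount p a
∈basisAS⁻ p ab∈B
  with find (∈-concatMap⁻ (λ i → map (i ,_) (upTo (jCount p i))) {xs = upTo (p ∸ 1)} ab∈B)
... | i , i∈ , ab∈row with ∈-map⁻ (i ,_) ab∈row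
...   | j , j∈ , refl = ∈-upTo⁻ i∈ , ∈-upTo⁻ j∈

lexLtᵇ⁻ : ∀ {a b m n} → T (lexLtᵇ (a , b) (m , n)) → a < m ⊎ (a ≡ m × b < n)
lexLtᵇ⁻ {a} {b} {m} {n} lt with Equivalence.to T-∨ lt
... | inj₁ a<m  = inj₁ (<ᵇ⇒< a m a<m)
... | inj₂ a=m∧b<n with Equivalence.to T-∧ a=m∧b<n
...   | a≡m , b<n = inj₂ (≡ᵇ⇒≡ a m a≡m , <ᵇ⇒< b n b<n)

dAS≡ : ∀ p → dAS p ≡ p * p + 1
dAS≡ p = cong (λ x → p * x + 1) (*-identityʳ p)

ceilDiv-bound : ∀ c p′ → c ≤ suc p′ → c * dAS (suc p′) + p′ < (2 + c * suc p′) * suc p′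
ceilDiv-bound c p′ c≤p = begin-strict
  c * dAS (suc p′) + p′                ≡⟨ cong (λ x → c * x + p′) (dAS≡ (suc p′)) ⟩
  c * (suc p′ * suc p′ + 1) + p′       ≡⟨ solve (c ∷ p′ ∷ []) ⟩
  c * suc p′ * suc p′ + (c + p′)       <⟨ +-monoʳ-< _ (+-mono-≤-< c≤p (n<1+n p′)) ⟩
  c * suc p′ * suc p′ + (suc p′ + suc p′) ≡⟨ solve (c ∷ p′ ∷ []) ⟩
  (2 + c * suc p′) * suc p′            ∎
  where open ≤-Reasoning

-- With c = p - a - 1 ≤ p, the ceiling ⌈c (p² + 1) / p⌉ is at most c p + 1.
jCount≤ : ∀ p a → jCount p a ≤ (p ∸ a ∸ 1) * p
jCount≤ zero       a = z≤n
jCount≤ p@(suc p′) a = ∸-monoˡ-≤ 1 (s≤s⁻¹ (m<n*o⇒m/o<n (ceilDiv-bound (p ∸ a ∸ 1) p′ c≤p)))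
  where
  c≤p : p ∸ a ∸ 1 ≤ p
  c≤p = ≤-trans (m∸n≤m (p ∸ a) 1) (m∸n≤m p a)

cartierExponent : ℕ → ℕ → ℕ → ℕ → ℕ
cartierExponent p s v n = dAS p * s + eAS p * v + n + 1

cartierCoeff-below : ∀ p a b l t → a < l → cartierCoeff p a b l t ≡ 0
cartierCoeff-below p a b l t a<l rewrite k>n⇒nCk≡0 a<l = refl

cartierCoeff-≡0 : ∀ p a b l t →
  (∀ s v → s + v ≡ a ∸ l → cartierExponent p s v b ≢ p * (t + 1)) →
  cartierCoeff p a b l t ≡ 0
cartierCoeff-≡0 p a b l t miss =
  trans (cong ((a C l) *_) (sumUpTo-≡0 _ _ summand≡0)) (*-zeroʳ (a C l))
  where
  summand≡0 : ∀ s → s < suc (a ∸ l) →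
    (if does (cartierExponent p s (a ∸ l ∸ s) b ≟ p * (t + 1)) then (a ∸ l) C s else 0) ≡ 0
  summand≡0 s s≤a-l
    rewrite dec-false (_ ≟ _) (miss s (a ∸ l ∸ s) (m+[n∸m]≡n (s≤s⁻¹ s≤a-l))) = refl

cartierCoeff-single : ∀ p a b l t {s v} → eAS p < dAS p → s + v ≡ a ∸ l →
  cartierExponent p s v b ≡ p * (t + 1) → cartierCoeff p a b l t ≡ (a C l) * ((a ∸ l) C s)
cartierCoeff-single p a b l t {s} {v} e<d s+v≡k hit =
  cong ((a C l) *_) (trans (sumUpTo-single (suc k) summand (s≤s s≤k) missElsewhere) hitAtS)
  where
  k = a ∸ l
  summand : ℕ → ℕ
  summand s′ = if does (cartierExponent p s′ (k ∸ s′) b ≟ p * (t + 1)) then k C s′ else 0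
  s≤k : s ≤ k
  s≤k = subst (s ≤_) s+v≡k (m≤m+n s v)
  k∸s≡v : k ∸ s ≡ v
  k∸s≡v = trans (cong (_∸ s) (sym s+v≡k)) (m+n∸m≡n s v)
  hitAtS : summand s ≡ k C s
  hitAtS rewrite k∸s≡v | dec-true (_ ≟ _) hit = refl
  miss : ∀ s′ → s′ ≤ k → s′ ≢ s → cartierExponent p s′ (k ∸ s′) b ≢ p * (t + 1)
  miss s′ s′≤k s′≢s eq = s′≢s (weight-injective e<d (trans (m+[n∸m]≡n s′≤k) (sym s+v≡k))
    (+-cancelʳ-≡ b _ _ (+-cancelʳ-≡ 1 _ _ (trans eq (sym hit)))))
  missElsewhere : ∀ s′ → s′ < suc k → s′ ≢ s → summand s′ ≡ 0
  missElsewhere s′ s′≤k s′≢s rewrite dec-false (_ ≟ _) (miss s′ (s≤s⁻¹ s′≤k) s′≢s) = refl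

cartierExponent-<-sameRow : ∀ p {s v s′ v′ b n} → eAS p < dAS p → s′ ≤ s → s′ + v′ ≡ s + v → b < n →
  cartierExponent p s′ v′ b < cartierExponent p s v n
cartierExponent-<-sameRow p {s} {v} {s′} {v′} e<d s′≤s same b<n with m≤n⇒m<n∨m≡n s′≤s
... | inj₁ s′<s = +-monoˡ-< 1 (+-mono-<-≤ (weight-< e<d s′<s same) (<⇒≤ b<n))
... | inj₂ refl with +-cancelˡ-≡ s v′ v same
...   | refl = +-monoˡ-< 1 (+-monoʳ-< _ b<n)

module _ (q : ℕ) where

  private
    p : ℕ
    p = 1 + 2 * q

  eAS≡ : eAS p ≡ (q + 1) * (p + 1)
  eAS≡ = begin
    dAS p / 2 + p                        ≡⟨ cong (λ x → x / 2 + p) dAS≡[2q²+2q+1]*2 ⟩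
    (2 * q * q + 2 * q + 1) * 2 / 2 + p  ≡⟨ cong (_+ p) (m*n/n≡m (2 * q * q + 2 * q + 1) 2) ⟩
    2 * q * q + 2 * q + 1 + (1 + 2 * q)  ≡⟨ solve (q ∷ []) ⟩
    (q + 1) * (1 + 2 * q + 1)            ∎
    where
    open ≡-Reasoning
    dAS≡[2q²+2q+1]*2 : dAS p ≡ (2 * q * q + 2 * q + 1) * 2
    dAS≡[2q²+2q+1]*2 = trans (dAS≡ (1 + 2 * q)) (solve (q ∷ []))

  dAS≡eAS+2q² : dAS p ≡ eAS p + 2 * q * q
  dAS≡eAS+2q² = begin
    dAS p                                        ≡⟨ dAS≡ (1 + 2 * q) ⟩
    (1 + 2 * q) * (1 + 2 * q) + 1                ≡⟨ solve (q ∷ []) ⟩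
    (q + 1) * (1 + 2 * q + 1) + 2 * q * q        ≡⟨ cong (_+ 2 * q * q) eAS≡ ⟨
    eAS p + 2 * q * q                            ∎
    where open ≡-Reasoning

  eAS≤dAS : eAS p ≤ dAS p
  eAS≤dAS = subst (eAS p ≤_) (sym dAS≡eAS+2q²) (m≤m+n (eAS p) (2 * q * q))

  eAS<dAS : 1 ≤ q → eAS p < dAS p
  eAS<dAS 1≤q = subst (eAS p <_) (sym dAS≡eAS+2q²) (m<m+n (eAS p) 0<2q²)
    where
    0<2q² : 0 < 2 * q * q
    0<2q² = *-mono-≤ (*-mono-≤ {1} {2} (s≤s z≤n) 1≤q) 1≤q

  cartierExponent≡ : ∀ s v n →
    cartierExponent p s v n ≡ p * (p * s + (q + 1) * v) + (s + (q + 1) * v + n + 1)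
  cartierExponent≡ s v n = begin
    dAS p * s + eAS p * v + n + 1
      ≡⟨ cong₂ (λ d e → d * s + e * v + n + 1) (dAS≡ (1 + 2 * q)) eAS≡ ⟩
    ((1 + 2 * q) * (1 + 2 * q) + 1) * s + (q + 1) * (1 + 2 * q + 1) * v + n + 1
      ≡⟨ solve (q ∷ s ∷ v ∷ n ∷ []) ⟩
    (1 + 2 * q) * ((1 + 2 * q) * s + (q + 1) * v) + (s + (q + 1) * v + n + 1)
      ∎
    where open ≡-Reasoning

  ∣residue⇒∣cartierExponent : ∀ {s v n} → p ∣ s + (q + 1) * v + n + 1 → p ∣ cartierExponent p s v n
  ∣residue⇒∣cartierExponent {s} {v} {n} p∣r =
    subst (p ∣_) (sym (cartierExponent≡ s v n)) (∣m∣n⇒∣m+n (m∣m*n (p * s + (q + 1) * v)) p∣r)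

  ∣cartierExponent⇒∣residue : ∀ {s v n} → p ∣ cartierExponent p s v n → p ∣ s + (q + 1) * v + n + 1
  ∣cartierExponent⇒∣residue {s} {v} {n} p∣E =
    ∣m+n∣m⇒∣n (subst (p ∣_) (cartierExponent≡ s v n) p∣E) (m∣m*n (p * s + (q + 1) * v))

  jCount-odd≤ : ∀ {a} δ → q ≤ a + δ → jCount p a ≤ (q + δ) * p
  jCount-odd≤ {a} δ q≤a+δ = ≤-trans (jCount≤ p a) (*-monoˡ-≤ p rows≤q+δ)
    where
    rows≤q+δ : p ∸ a ∸ 1 ≤ q + δ
    rows≤q+δ rewrite ∸-+-assoc p a 1 = m≤n+o⇒m∸n≤o p (a + 1) (begin
      1 + 2 * q          ≡⟨ solve (q ∷ []) ⟩
      q + (1 + q)        ≤⟨ +-monoˡ-≤ (1 + q) q≤a+δ ⟩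
      a + δ + (1 + q)    ≡⟨ solve (a ∷ δ ∷ q ∷ []) ⟩
      a + 1 + (q + δ)    ∎)
      where open ≤-Reasoning

  [q+1+δ]*p≤dAS*δ+eAS : ∀ δ → (q + suc δ) * p ≤ dAS p * δ + eAS p
  [q+1+δ]*p≤dAS*δ+eAS δ = begin
    (q + suc δ) * (1 + 2 * q)
      ≤⟨ m≤m+n _ (4 * q * q * δ + 2 * q * δ + δ + q + 1) ⟩
    (q + suc δ) * (1 + 2 * q) + (4 * q * q * δ + 2 * q * δ + δ + q + 1)
      ≡⟨ solve (q ∷ δ ∷ []) ⟩
    ((1 + 2 * q) * (1 + 2 * q) + 1) * δ + (q + 1) * (1 + 2 * q + 1)
      ≡⟨ cong₂ (λ d e → d * δ + e) (dAS≡ (1 + 2 * q)) eAS≡ ⟨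
    dAS p * δ + eAS p
      ∎
    where open ≤-Reasoning

  residueSplit : ∀ r → r < p → ∃₂ λ s v → v ≤ 1 × s + v ≤ q × s + (q + 1) * v ≡ r
  residueSplit r r<p with ≤-<-connex r q
  ... | inj₁ r≤q = r , 0 , z≤n , subst (_≤ q) (sym (+-identityʳ r)) r≤q , solve (r ∷ q ∷ [])
  ... | inj₂ q<r with m≤n⇒∃[o]m+o≡n q<r
  ...   | s , refl = s , 1 , s≤s z≤n , s+1≤q , solve (s ∷ q ∷ [])
    where
    s+1≤q : s + 1 ≤ q
    s+1≤q = +-cancelˡ-≤ q (s + 1) q (begin
      q + (s + 1)  ≡⟨ solve (q ∷ s ∷ []) ⟩
      suc q + s    ≤⟨ s≤s⁻¹ r<p ⟩
      2 * q        ≡⟨ solve (q ∷ []) ⟩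
      q + q        ∎)
      where open ≤-Reasoning

  record Pivot (n : ℕ) : Set where
    field
      s v t : ℕ
      v≤1   : v ≤ 1
      s+v≤q : s + v ≤ q
      hits  : cartierExponent p s v n ≡ p * (t + 1)

  pivot : ∀ n → Pivot n
  pivot n with complementResidue p (n + 1)
  ... | r , r<p , p∣r+n+1 with residueSplit r r<p
  ...   | s , v , v≤1 , s+v≤q , refl = record
    { s = s ; v = v ; t = proj₁ hit ; v≤1 = v≤1 ; s+v≤q = s+v≤q ; hits = proj₂ hit }
    where
    p∣residue : p ∣ s + (q + 1) * v + n + 1
    p∣residue = subst (p ∣_) (sym (+-assoc (s + (q + 1) * v) n 1)) p∣r+n+1
    hit : ∃ λ t → cartierExponent p s v n ≡ p * (t + 1)
    hit = ∣+1⇒≡*[+1] (∣residue⇒∣cartierExponent {s} {v} {n} p∣residue)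

  cartierExponent-<-shorterRow : ∀ {s v s′ v′ a b δ} n → v ≤ 1 → s′ + v′ + suc δ ≡ s + v →
    q ≤ a + suc δ → b < jCount p a → cartierExponent p s′ v′ b < cartierExponent p s v n
  cartierExponent-<-shorterRow {s} {v} {s′} {v′} {a} {b} {δ} n v≤1 same q≤a+1+δ b<j = begin-strict
    dAS p * s′ + eAS p * v′ + b + 1             ≡⟨ +-assoc _ b 1 ⟩
    dAS p * s′ + eAS p * v′ + (b + 1)           ≤⟨ +-mono-≤ (weight≤ s′ v′ eAS≤dAS) b+1≤ ⟩
    dAS p * (s′ + v′) + (q + suc δ) * p         ≤⟨ +-monoʳ-≤ _ ([q+1+δ]*p≤dAS*δ+eAS δ) ⟩
    dAS p * (s′ + v′) + (dAS p * δ + eAS p)     ≡⟨ +-assoc (dAS p * (s′ + v′)) _ _ ⟨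
    dAS p * (s′ + v′) + dAS p * δ + eAS p       ≡⟨ cong (_+ eAS p) (*-distribˡ-+ (dAS p) (s′ + v′) δ) ⟨
    dAS p * (s′ + v′ + δ) + eAS p               ≤⟨ weight≥ eAS≤dAS v≤1 s+v≡1+k′+δ ⟩
    dAS p * s + eAS p * v                       <⟨ s≤s (m≤m+n _ n) ⟩
    suc (dAS p * s + eAS p * v + n)             ≡⟨ +-comm 1 _ ⟩
    dAS p * s + eAS p * v + n + 1               ∎
    where
    open ≤-Reasoning
    s+v≡1+k′+δ : s + v ≡ suc (s′ + v′ + δ)
    s+v≡1+k′+δ = trans (sym same) (+-suc (s′ + v′) δ)
    b+1≤ : b + 1 ≤ (q + suc δ) * p
    b+1≤ = ≤-trans (subst (_≤ jCount p a) (+-comm 1 b) b<j) (jCount-odd≤ (suc δ) q≤a+1+δ)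

  nextSplit-misses : ∀ {s v s′ v′ b n m} → s′ ≡ suc s × v′ ≡ 0 × v ≡ 1 → s + v ≤ q → q ≤ m →
    n < jCount p m → p ∣ cartierExponent p s v n →
    cartierExponent p s′ v′ b ≢ cartierExponent p s v n
  nextSplit-misses {s} {b = b} {n} {m} (refl , refl , refl) s+1≤q q≤m n<j p∣E eq =
    <⇒≱ residue<p (∣⇒≤ p∣residue)
    where
    open ≤-Reasoning
    n≡2q²+b : n ≡ 2 * q * q + b
    n≡2q²+b = sym (+-cancelˡ-≡ (eAS p) (2 * q * q + b) n (begin-equality
      eAS p + (2 * q * q + b)  ≡⟨ +-assoc (eAS p) _ b ⟨
      eAS p + 2 * q * q + b    ≡⟨ cong (_+ b) dAS≡eAS+2q² ⟨
      dAS p + b                ≡⟨ shiftedSplit (dAS p) (eAS p) s b n eq ⟩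
      eAS p + n                ∎))
    b<q : b < q
    b<q = +-cancelˡ-< (2 * q * q) b q (begin-strict
      2 * q * q + b            ≡⟨ n≡2q²+b ⟨
      n                        <⟨ n<j ⟩
      jCount p m               ≤⟨ jCount-odd≤ 0 (≤-trans q≤m (m≤m+n m 0)) ⟩
      (q + 0) * (1 + 2 * q)    ≡⟨ solve (q ∷ []) ⟩
      2 * q * q + q            ∎)
    p∣residue : p ∣ suc s + (q + 1) * 0 + b + 1
    p∣residue = ∣cartierExponent⇒∣residue {suc s} {0} {b} (subst (p ∣_) (sym eq) p∣E)
    residue<p : suc s + (q + 1) * 0 + b + 1 < p
    residue<p = begin-strict
      suc s + (q + 1) * 0 + b + 1  ≡⟨ solve (s ∷ q ∷ b ∷ []) ⟩
      (s + 1) + suc b              ≤⟨ +-mono-≤ s+1≤q b<q ⟩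
      q + q                        <⟨ n<1+n (q + q) ⟩
      suc (q + q)                  ≡⟨ solve (q ∷ []) ⟩
      1 + 2 * q                    ∎

  lowerExponent-≢ : ∀ {m n} → 1 ≤ q → q ≤ m → n < jCount p m → (π : Pivot n) →
    let open Pivot π in
    ∀ {a b s′ v′} → m ∸ (s + v) ≤ a → a < m ⊎ (a ≡ m × b < n) → b < jCount p a →
    s′ + v′ ≡ a ∸ (m ∸ (s + v)) → cartierExponent p s′ v′ b ≢ cartierExponent p s v n
  lowerExponent-≢ {m} {n} 1≤q q≤m n<j π {a} {b} {s′} {v′} l≤a (inj₁ a<m) b<j k′≡a∸l =
    <⇒≢ (cartierExponent-<-shorterRow n v≤1 same q≤a+1+δ b<j)
    where
    open Pivot π
    open ≡-Reasoning
    l = m ∸ (s + v)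
    k≤m : s + v ≤ m
    k≤m = ≤-trans s+v≤q q≤m
    k′<k : a ∸ l < s + v
    k′<k = subst (a ∸ l <_) (m∸[m∸n]≡n k≤m) (∸-monoˡ-< a<m l≤a)
    δ : ℕ
    δ = proj₁ (m≤n⇒∃[o]m+o≡n k′<k)
    1+k′+δ≡k : suc (a ∸ l) + δ ≡ s + v
    1+k′+δ≡k = proj₂ (m≤n⇒∃[o]m+o≡n k′<k)
    same : s′ + v′ + suc δ ≡ s + v
    same = trans (+-suc (s′ + v′) δ) (trans (cong (λ k′ → suc (k′ + δ)) k′≡a∸l) 1+k′+δ≡k)
    q≤a+1+δ : q ≤ a + suc δ
    q≤a+1+δ = subst (q ≤_) (sym (begin
      a + suc δ            ≡⟨ cong (_+ suc δ) (m+[n∸m]≡n l≤a) ⟨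
      l + (a ∸ l) + suc δ  ≡⟨ +-assoc l (a ∸ l) (suc δ) ⟩
      l + (a ∸ l + suc δ)  ≡⟨ cong (l +_) (trans (+-suc (a ∸ l) δ) 1+k′+δ≡k) ⟩
      l + (s + v)          ≡⟨ m∸n+n≡m k≤m ⟩
      m                    ∎)) q≤m
  lowerExponent-≢ {m} {n} 1≤q q≤m n<j π {a} {b} {s′} {v′} l≤a (inj₂ (refl , b<n)) b<j k′≡a∸l =
    bySplit (≤-<-connex s′ s)
    where
    open Pivot π
    same : s′ + v′ ≡ s + v
    same = trans k′≡a∸l (m∸[m∸n]≡n (≤-trans s+v≤q q≤m))
    bySplit : s′ ≤ s ⊎ s < s′ → cartierExponent p s′ v′ b ≢ cartierExponent p s v n
    bySplit (inj₁ s′≤s) = <⇒≢ (cartierExponent-<-sameRow p (eAS<dAS 1≤q) s′≤s same b<n)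
    bySplit (inj₂ s<s′) = nextSplit-misses (nextSplit v≤1 s<s′ same) s+v≤q q≤m n<j
                            (subst (p ∣_) (sym hits) (m∣m*n (t + 1)))

  lowerBasis-misses : ∀ {m n} → 1 ≤ q → q ≤ m → n < jCount p m → (π : Pivot n) →
    let open Pivot π in
    ∀ {β} → β ∈ lowerBasis p (m , n) → cartierCoeff p (proj₁ β) (proj₂ β) (m ∸ (s + v)) t ≡ 0
  lowerBasis-misses {m} {n} 1≤q q≤m n<j π {a , b} β∈ = byPosition (a <? m ∸ (s + v))
    where
    open Pivot π
    l = m ∸ (s + v)
    β∈B×β<α : (a , b) ∈ basisAS p × T (lexLtᵇ (a , b) (m , n))
    β∈B×β<α = ∈-filter⁻ (T? ∘ λ β → lexLtᵇ β (m , n)) β∈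
    byPosition : Dec (a < l) → cartierCoeff p a b l t ≡ 0
    byPosition (yes a<l) = cartierCoeff-below p a b l t a<l
    byPosition (no  a≮l) = cartierCoeff-≡0 p a b l t λ s′ v′ k′≡a∸l hit →
      lowerExponent-≢ 1≤q q≤m n<j π (≮⇒≥ a≮l) (lexLtᵇ⁻ (proj₂ β∈B×β<α))
        (proj₂ (∈basisAS⁻ p (proj₁ β∈B×β<α))) k′≡a∸l (trans hit (sym hits))

  separatingMonomial : ∀ {m n} → 1 ≤ q → Prime p → (m , n) ∈ basisAS p → q ≤ m →
    ∃₂ (Separates p (m , n))
  separatingMonomial {m} {n} 1≤q p-prime α∈B q≤m =
    l , t , p∤leading , lowerBasis-misses 1≤q q≤m n<j π
    where
    n<j : n < jCount p m
    n<j = proj₂ (∈basisAS⁻ p α∈B)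
    π = pivot n
    open Pivot π
    l = m ∸ (s + v)
    k≡m∸l : s + v ≡ m ∸ l
    k≡m∸l = sym (m∸[m∸n]≡n (≤-trans s+v≤q q≤m))
    leading : cartierCoeff p m n l t ≡ (m C l) * ((m ∸ l) C s)
    leading = cartierCoeff-single p m n l t (eAS<dAS 1≤q) k≡m∸l hits
    m<p : m < p
    m<p = m<n⇒m<1+n (proj₁ (∈basisAS⁻ p α∈B))
    p∤leading : p ∤ cartierCoeff p m n l t
    p∤leading p∣coeff with euclidsLemma (m C l) ((m ∸ l) C s) p-prime (subst (p ∣_) leading p∣coeff)
    ... | inj₁ p∣mCl = prime∤nCk p-prime (m∸n≤m m (s + v)) m<p p∣mCl
    ... | inj₂ p∣kCs = prime∤nCk p-prime (subst (s ≤_) k≡m∸l (m≤m+n s v))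
                         (≤-<-trans (m∸n≤m m l) m<p) p∣kCs

oddPrime≡1+2q : ∀ {p} → Prime p → ¬ (2 ∣ p) → ∃ λ q → 1 ≤ q × p ≡ 1 + 2 * q
oddPrime≡1+2q {p} p-prime 2∤p with p % 2 | m%n<n p 2 | m≡m%n+[m/n]*n p 2
... | 0    | _             | p≡[p/2]*2   = ⊥-elim (2∤p (divides (p / 2) p≡[p/2]*2))
... | 2+ _ | s≤s (s≤s ()) | _
... | 1    | _             | p≡1+[p/2]*2 =
  p / 2 , n≢0⇒n>0 p/2≢0 , trans p≡1+[p/2]*2 (cong suc (*-comm (p / 2) 2))
  where
  p/2≢0 : p / 2 ≢ 0
  p/2≢0 p/2≡0 = nonTrivial⇒≢1 {{prime⇒nonTrivial p-prime}}
    (trans p≡1+[p/2]*2 (cong (λ x → 1 + x * 2) p/2≡0))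

-- Algebraic closedness is not needed: every coefficient involved lies in the prime field.
lemma2p9 : ∀ {c ℓ : Level} (p : ℕ) → Prime p → ¬ (2 ∣ p) →
    (K : CommutativeRing c ℓ) → IsField K → HasChar K p → IsAlgClosed K →
    ∀ (m n : ℕ) → (m , n) ∈ basisAS p → p ∸ 1 ≤ 2 * m →
    ¬ InSpanOfLower K p (m , n)
lemma2p9 p p-prime 2∤p K K-field char _ m n α∈B p∸1≤2m with oddPrime≡1+2q p-prime 2∤p
... | q , 1≤q , refl = separated⇒¬InSpanOfLower K (IsField.1≉0 K-field) p-prime char
                         (separatingMonomial q 1≤q p-prime α∈B (*-cancelˡ-≤ 2 p∸1≤2m))
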